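{- Let $G=(V,E)$ be a directed acyclic graph with source $s$ and destination $t$ in which every vertex and every edge lies on some directed $s$-$t$ path. Then the number of directed $s$-$t$ paths in $G$ is at least $1+\sum_{v\in V\setminus\{t\}} (\deg^+(v)-1)$.
   Context: $\deg^+(v)$ denotes the out-degree of $v$. -}

module Defs where

open import Data.Nat using (ℕ; suc)
open import Data.Bool using (Bool; true; false; if_then_else_)
open import Data.Fin using (Fin; _≟_)
open import Data.List using (List; []; _∷_; _++_; foldr; map; allFin; filter; length)
open import Data.List.Membership.Propositional using (_∈_)
open import Data.List.Relation.Unary.Unique.Propositional using (Unique)
open import Data.Integer using (ℤ; +_; _-_; _+_)
open import Data.Product using (Σ; ∃; _×_; _,_)
open import Relation.Binary.PropositionalEquality using (_≡_; _≢_)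
open import Relation.Nullary.Decidable using (does)
open import Relation.Nullary using (¬_)

Digraph : ℕ → Set
Digraph n = Fin n → Fin n → Bool

Edge : ∀ {n} → Digraph n → Fin n → Fin n → Set
Edge E u v = E u v ≡ true

outdeg : ∀ {n} → Digraph n → Fin n → ℕ
outdeg {n} E v = length (filter (λ w → E v w ≟b true) (allFin n))
  where
  open import Data.Bool using () renaming (_≟_ to _≟b_)

data Walk {n} (E : Digraph n) : Fin n → Fin n → List (Fin n) → Set where
  here : ∀ {v} → Walk E v v (v ∷ [])
  step : ∀ {u w v xs} → Edge E u w → Walk E w v xs → Walk E u v (u ∷ xs)

Acyclic : ∀ {n} → Digraph n → Set
Acyclic {n} E = ∀ (v w : Fin n) (xs : List (Fin n)) → Edge E v w → ¬ Walk E w v xs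

IsPath : ∀ {n} → Digraph n → Fin n → Fin n → List (Fin n) → Set
IsPath E s t p = Walk E s t p × Unique p

Consecutive : ∀ {n} → Fin n → Fin n → List (Fin n) → Set
Consecutive {n} u v p = Σ (List (Fin n)) λ xs → Σ (List (Fin n)) λ ys → p ≡ xs ++ (u ∷ v ∷ ys)

VerticesOnPaths : ∀ {n} → Digraph n → Fin n → Fin n → Set
VerticesOnPaths {n} E s t = ∀ (v : Fin n) → ∃ λ p → IsPath E s t p × v ∈ p

EdgesOnPaths : ∀ {n} → Digraph n → Fin n → Fin n → Set
EdgesOnPaths {n} E s t = ∀ (u v : Fin n) → Edge E u v → ∃ λ p → IsPath E s t p × Consecutive u v p

sumℤ : List ℤ → ℤ
sumℤ = foldr _+_ (+ 0)

bound : ∀ {n} → Digraph n → Fin n → ℤ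
bound {n} E t = + 1 + sumℤ (map (λ v → + outdeg E v - + 1) (filter (λ v → Relation.Nullary.¬? (v ≟ t)) (allFin n)))
  where import Relation.Nullary

-- Let c(u) = deg⁺(u) − 1 and W(v) = Σ { c(u) | u ≠ t lies on a v–t path }.  A v–t path with
-- v ≠ t is v followed by a w–t path for an out-neighbour w, so W(v) ≤ c(v) + Σ_w W(w).  Every
-- v ≠ t lies on an s–t path and so has an out-edge, whence 1 + c(v) = deg⁺(v) and, by induction
-- along the acyclic order,  #(v–t paths) = Σ_w #(w–t paths) ≥ Σ_w (1 + W(w)) ≥ 1 + W(v).
-- At v = s every vertex lies on a v–t path, so W(s) is the sum in the bound.
module Submission where

open import Defs
open import Data.Nat using (ℕ)
open import Data.Fin using (Fin)
open import Data.List using (List; length)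
open import Data.List.Relation.Unary.All using (All)
open import Data.List.Relation.Unary.Unique.Propositional using (Unique)
open import Data.Integer using (_≤_; +_)
open import Data.Product using (∃; _×_)

open import Data.Bool as Bool using (true; if_then_else_)
open import Data.Empty using (⊥-elim)
open import Data.Fin as Fin using (_≟_)
open import Data.Fin.Properties using (injective⇒≤)
import Data.Integer as ℤ
import Data.Integer.Properties as ℤ
open import Data.List using ([]; _∷_; _++_; [_]; map; concat; concatMap; filter; allFin; lookup)
open import Data.List.Membership.Propositional using (_∈_; _∉_)
open import Data.List.Membership.Propositional.Properties
  using ( ∈-++⁻; ∈-map⁺; ∈-map⁻; ∈-concat⁺′; ∈-concat⁻′; ∈-filter⁺; ∈-filter⁻; ∈-allFin
        ; ∈-lookup; ∈-length)
open import Data.List.Properties using (length-++; length-map; map-cong; concat-++; ∷-injectiveʳ)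
open import Data.List.Relation.Binary.Disjoint.Propositional using (Disjoint)
open import Data.List.Relation.Unary.All using ([]; _∷_)
import Data.List.Relation.Unary.All as All
open import Data.List.Relation.Unary.All.Properties using (¬Any⇒All¬) renaming (map⁺ to All-map⁺)
import Data.List.Relation.Unary.AllPairs as AllPairs
import Data.List.Relation.Unary.AllPairs.Properties as AllPairs
open import Data.List.Relation.Unary.Any using (here; there)
open import Data.List.Relation.Unary.Unique.Propositional using ([]; _∷_)
import Data.List.Relation.Unary.Unique.Propositional.Properties as Unique
open import Data.Nat using (zero; suc; _+_; _∸_; z≤n; s≤s; s≤s⁻¹) renaming (_≤_ to _≤ℕ_)
open import Data.Nat.ListAction using (sum)
import Data.Nat.Properties as ℕ
open import Algebra.Properties.CommutativeSemigroup ℕ.+-commutativeSemigroup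
  using (interchange; x∙yz≈y∙xz)
open import Data.Product using (_,_; proj₂)
open import Data.Sum using (_⊎_; inj₁; inj₂)
open import Function using (_∘_)
open import Relation.Binary.PropositionalEquality using (_≡_; _≢_; refl; sym; trans; cong; cong₂; subst)
open import Relation.Nullary using (Dec; yes; no; does; ¬?)

private
  variable
    A B : Set

length-concatMap : (F : A → List B) (xs : List A) → length (concatMap F xs) ≡ sum (map (length ∘ F) xs)
length-concatMap F [] = refl
length-concatMap F (x ∷ xs) = trans (length-++ (F x)) (cong (λ m → length (F x) + m) (length-concatMap F xs))

length+sum≤sum : (xs : List A) {f g : A → ℕ} → (∀ {x} → x ∈ xs → suc (f x) ≤ℕ g x) →
                 length xs + sum (map f xs) ≤ℕ sum (map g xs)
length+sum≤sum [] _ = z≤n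
length+sum≤sum (x ∷ xs) {f} f<g =
  ℕ.≤-trans (ℕ.≤-reflexive (cong suc (x∙yz≈y∙xz (length xs) (f x) (sum (map f xs)))))
            (ℕ.+-mono-≤ (f<g (here refl)) (length+sum≤sum xs (f<g ∘ there)))

∈-concat-map-∷⁻ : ∀ {u v : A} qs → u ∈ concat (map (v ∷_) qs) → u ∈ [ v ] ⊎ u ∈ concat qs
∈-concat-map-∷⁻ {v = v} qs u∈
  with p , u∈p , p∈ ← ∈-concat⁻′ (map (v ∷_) qs) u∈
  with q , q∈qs , refl ← ∈-map⁻ (v ∷_) p∈
  with u∈p
... | here u≡v = inj₁ (here u≡v)
... | there u∈q = inj₂ (∈-concat⁺′ u∈q q∈qs)

lookup-injective : {xs : List A} → Unique xs → ∀ {i j} → lookup xs i ≡ lookup xs j → i ≡ j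
lookup-injective (_ ∷ _) {Fin.zero} {Fin.zero} _ = refl
lookup-injective (x∉xs ∷ _) {Fin.zero} {Fin.suc j} eq = ⊥-elim (All.lookup x∉xs (∈-lookup j) eq)
lookup-injective (x∉xs ∷ _) {Fin.suc i} {Fin.zero} eq = ⊥-elim (All.lookup x∉xs (∈-lookup i) (sym eq))
lookup-injective (_ ∷ unique) {Fin.suc i} {Fin.suc j} eq = cong Fin.suc (lookup-injective unique eq)

unique-length≤ : ∀ {n} {xs : List (Fin n)} → Unique xs → length xs ≤ℕ n
unique-length≤ unique = injective⇒≤ (lookup-injective unique)

sumℤ-pred : (f : A → ℕ) (xs : List A) → All (λ x → 1 ≤ℕ f x) xs →
            sumℤ (map (λ x → + f x ℤ.- + 1) xs) ≡ + sum (map (λ x → f x ∸ 1) xs)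
sumℤ-pred f [] [] = refl
sumℤ-pred f (x ∷ xs) (1≤fx ∷ ps) = cong₂ ℤ._+_ (ℤ.⊖-≥ 1≤fx) (sumℤ-pred f xs ps)

module Weight {n : ℕ} (c : Fin n → ℕ) where
  open import Data.List.Membership.DecPropositional (_≟_ {n = n}) using (_∈?_)

  restrict : List (Fin n) → Fin n → ℕ
  restrict xs u = if does (u ∈? xs) then c u else 0

  weight : List (Fin n) → List (Fin n) → ℕ
  weight U xs = sum (map (restrict xs) U)

  weight-cover : ∀ U {xs ys zs} → (∀ {u} → u ∈ xs → u ∈ ys ⊎ u ∈ zs) →
                 weight U xs ≤ℕ weight U ys + weight U zs
  weight-cover [] cover = z≤n
  weight-cover (u ∷ U) {xs} {ys} {zs} cover =
    ℕ.≤-trans (ℕ.+-mono-≤ point (weight-cover U cover))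
              (ℕ.≤-reflexive (interchange (restrict ys u) (restrict zs u) (weight U ys) (weight U zs)))
    where
    point : restrict xs u ≤ℕ restrict ys u + restrict zs u
    point with u ∈? xs | u ∈? ys | u ∈? zs
    ... | no _ | _ | _ = z≤n
    ... | yes _ | yes _ | _ = ℕ.m≤m+n _ _
    ... | yes _ | no _ | yes _ = ℕ.≤-refl
    ... | yes u∈xs | no u∉ys | no u∉zs with cover u∈xs
    ...   | inj₁ u∈ys = ⊥-elim (u∉ys u∈ys)
    ...   | inj₂ u∈zs = ⊥-elim (u∉zs u∈zs)

  weight-disjoint : ∀ {U xs} → All (_∉ xs) U → weight U xs ≡ 0
  weight-disjoint [] = refl
  weight-disjoint {u ∷ U} {xs} (u∉xs ∷ U∉xs) with u ∈? xs
  ... | yes u∈xs = ⊥-elim (u∉xs u∈xs)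
  ... | no _ = weight-disjoint U∉xs

  weight-singleton : ∀ {U} v → Unique U → weight U [ v ] ≤ℕ c v
  weight-singleton {[]} v _ = z≤n
  weight-singleton {u ∷ U} v (u∉U ∷ unique) with u ≟ v
  ... | yes refl =
    ℕ.≤-reflexive (trans (cong (λ w → c v + w) (weight-disjoint U∉[v])) (ℕ.+-identityʳ (c v)))
    where
    U∉[v] : All (_∉ [ v ]) U
    U∉[v] = All.map (λ { v≢w (here w≡v) → v≢w (sym w≡v) }) u∉U
  ... | no _ = weight-singleton v unique

  weight-complete : ∀ U {xs} → (∀ u → u ∈ xs) → weight U xs ≡ sum (map c U)
  weight-complete U {xs} covers = cong sum (map-cong point U)
    where
    point : ∀ u → restrict xs u ≡ c u
    point u with u ∈? xs
    ... | yes _ = refl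
    ... | no u∉xs = ⊥-elim (u∉xs (covers u))

  weight-concatMap : ∀ U (F : A → List (List (Fin n))) xs →
                     weight U (concat (concatMap F xs)) ≤ℕ sum (map (weight U ∘ concat ∘ F) xs)
  weight-concatMap U F [] = ℕ.≤-reflexive (weight-disjoint {xs = []} (All.universal (λ _ ()) U))
  weight-concatMap U F (x ∷ xs) =
    ℕ.≤-trans (weight-cover U split) (ℕ.+-monoʳ-≤ (weight U (concat (F x))) (weight-concatMap U F xs))
    where
    split : ∀ {u} → u ∈ concat (F x ++ concatMap F xs) →
            u ∈ concat (F x) ⊎ u ∈ concat (concatMap F xs)
    split {u} m = ∈-++⁻ (concat (F x)) (subst (u ∈_) (sym (concat-++ (F x) (concatMap F xs))) m)

module _ {n : ℕ} {E : Digraph n} where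

  walk-source-unique : ∀ {u u′ v v′ xs} → Walk E u v xs → Walk E u′ v′ xs → u ≡ u′
  walk-source-unique here here = refl
  walk-source-unique here (step _ _) = refl
  walk-source-unique (step _ _) here = refl
  walk-source-unique (step _ _) (step _ _) = refl

  walk-prefix : ∀ {u v w xs} → Walk E u v xs → w ∈ xs → ∃ λ ys → Walk E u w ys
  walk-prefix here (here refl) = _ , here
  walk-prefix (step _ _) (here refl) = _ , here
  walk-prefix (step e walk) (there w∈xs) with ys , prefix ← walk-prefix walk w∈xs = _ , step e prefix

  acyclic⇒walk-unique : Acyclic E → ∀ {u v xs} → Walk E u v xs → Unique xs
  acyclic⇒walk-unique acyclic here = [] ∷ []
  acyclic⇒walk-unique acyclic {u} (step {w = w} e walk) =
    ¬Any⇒All¬ _ (λ u∈xs → let _ , back = walk-prefix walk u∈xs in acyclic u w _ e back)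
      ∷ acyclic⇒walk-unique acyclic walk

  acyclic⇒walk-length≤ : Acyclic E → ∀ {u v xs} → Walk E u v xs → length xs ≤ℕ n
  acyclic⇒walk-length≤ acyclic walk = unique-length≤ (acyclic⇒walk-unique acyclic walk)

  walk-out-edge : ∀ {u v w xs} → Walk E u v xs → w ∈ xs → w ≢ v → ∃ (Edge E w)
  walk-out-edge here (here refl) w≢v = ⊥-elim (w≢v refl)
  walk-out-edge (step e _) (here refl) _ = _ , e
  walk-out-edge (step _ walk) (there w∈xs) w≢v = walk-out-edge walk w∈xs w≢v

module WalksInto {n : ℕ} (E : Digraph n) (t : Fin n) where

  edge? : ∀ v w → Dec (Edge E v w)
  edge? v w = E v w Bool.≟ true

  successors : Fin n → List (Fin n)
  successors v = filter (edge? v) (allFin n)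

  ∈-successors⁺ : ∀ {v w} → Edge E v w → w ∈ successors v
  ∈-successors⁺ {w = w} e = ∈-filter⁺ (edge? _) (∈-allFin w) e

  ∈-successors⁻ : ∀ {v w} → w ∈ successors v → Edge E v w
  ∈-successors⁻ w∈succ = proj₂ (∈-filter⁻ (edge? _) {xs = allFin n} w∈succ)

  -- the walks from v to t with at most suc k vertices
  walksTo : ℕ → Fin n → List (List (Fin n))
  walksTo k v with v ≟ t
  ... | yes _ = [ [ t ] ]
  walksTo zero v | no _ = []
  walksTo (suc k) v | no _ = map (v ∷_) (concatMap (walksTo k) (successors v))

  walksTo-sound : ∀ k v {p} → p ∈ walksTo k v → Walk E v t p
  walksTo-sound k v p∈ with v ≟ t
  walksTo-sound k v (here refl) | yes refl = here
  walksTo-sound (suc k) v p∈ | no _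
    with q , q∈ , refl ← ∈-map⁻ (v ∷_) p∈
    with qs , q∈qs , qs∈ ← ∈-concat⁻′ (map (walksTo k) (successors v)) q∈
    with w , w∈succ , refl ← ∈-map⁻ (walksTo k) qs∈
    = step (∈-successors⁻ w∈succ) (walksTo-sound k w q∈qs)

  walksTo-path : Acyclic E → ∀ {k v p} → p ∈ walksTo k v → IsPath E v t p
  walksTo-path acyclic p∈ = let walk = walksTo-sound _ _ p∈ in walk , acyclic⇒walk-unique acyclic walk

  walksTo-unique : ∀ k v → Unique (walksTo k v)
  walksTo-unique k v with v ≟ t
  ... | yes _ = [] ∷ []
  walksTo-unique zero v | no _ = []
  walksTo-unique (suc k) v | no _ =
    Unique.map⁺ ∷-injectiveʳ
      (Unique.concat⁺ (All-map⁺ (All.universal (walksTo-unique k) _))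
                      (AllPairs.map⁺ (AllPairs.map disjoint (Unique.filter⁺ (edge? v) (Unique.allFin⁺ n)))))
    where
    disjoint : ∀ {w w′} → w ≢ w′ → Disjoint (walksTo k w) (walksTo k w′)
    disjoint w≢w′ (p∈ , p∈′) =
      w≢w′ (walk-source-unique (walksTo-sound k _ p∈) (walksTo-sound k _ p∈′))

  walksTo-complete : Acyclic E → ∀ k {v p} → Walk E v t p → length p ≤ℕ suc k → p ∈ walksTo k v
  walksTo-complete acyclic k {v} walk _ with v ≟ t
  walksTo-complete acyclic k here _ | yes _ = here refl
  walksTo-complete acyclic k (step e walk) _ | yes refl = ⊥-elim (acyclic t _ _ e walk)
  walksTo-complete acyclic k here _ | no t≢t = ⊥-elim (t≢t refl)
  walksTo-complete acyclic zero (step e here) (s≤s ()) | no _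
  walksTo-complete acyclic zero (step e (step _ _)) (s≤s ()) | no _
  walksTo-complete acyclic (suc k) {v} (step {w = w} e walk) (s≤s short) | no _ =
    ∈-map⁺ (v ∷_) (∈-concat⁺′ (walksTo-complete acyclic k walk short)
                               (∈-map⁺ (walksTo k) (∈-successors⁺ e)))

  module Count (out-edge : ∀ v → v ≢ t → ∃ (Edge E v)) where

    others : List (Fin n)
    others = filter (λ v → ¬? (v ≟ t)) (allFin n)

    ∈-others⁻ : ∀ {v} → v ∈ others → v ≢ t
    ∈-others⁻ v∈others = proj₂ (∈-filter⁻ (λ v → ¬? (v ≟ t)) {xs = allFin n} v∈others)

    outdeg-positive : ∀ v → v ≢ t → 1 ≤ℕ outdeg E v
    outdeg-positive v v≢t = let _ , e = out-edge v v≢t in ∈-length (∈-successors⁺ e)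

    excess : Fin n → ℕ
    excess v = outdeg E v ∸ 1

    open Weight excess public

    walksTo-count : ∀ k v → (∀ {x xs} → Walk E v x xs → length xs ≤ℕ suc k) →
                    suc (weight others (concat (walksTo k v))) ≤ℕ length (walksTo k v)
    walksTo-count k v short with v ≟ t
    ... | yes refl = s≤s (ℕ.≤-reflexive (weight-disjoint (All.tabulate t∉[t])))
      where
      t∉[t] : ∀ {u} → u ∈ others → u ∉ [ t ]
      t∉[t] u∈others (here u≡t) = ∈-others⁻ u∈others u≡t
    walksTo-count zero v short | no v≢t with _ , e ← out-edge v v≢t with s≤s () ← short (step e here)
    walksTo-count (suc k) v short | no v≢t = begin
      suc (weight others (concat (map (v ∷_) paths)))
        ≤⟨ s≤s (weight-cover others (∈-concat-map-∷⁻ paths)) ⟩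
      suc (weight others [ v ] + weight others (concat paths))
        ≤⟨ s≤s (ℕ.+-mono-≤ (weight-singleton v (Unique.filter⁺ _ (Unique.allFin⁺ n)))
                           (weight-concatMap others (walksTo k) (successors v))) ⟩
      suc (excess v + weights)
        ≡⟨ cong (_+ weights) (ℕ.m+[n∸m]≡n (outdeg-positive v v≢t)) ⟩
      length (successors v) + weights
        ≤⟨ length+sum≤sum (successors v)
             (λ w∈succ → walksTo-count k _ (s≤s⁻¹ ∘ short ∘ step (∈-successors⁻ w∈succ))) ⟩
      sum (map (length ∘ walksTo k) (successors v))
        ≡⟨ sym (length-concatMap (walksTo k) (successors v)) ⟩
      length paths
        ≡⟨ sym (length-map (v ∷_) paths) ⟩
      length (map (v ∷_) paths) ∎
      where
      open ℕ.≤-Reasoning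
      paths = concatMap (walksTo k) (successors v)
      weights = sum (map (weight others ∘ concat ∘ walksTo k) (successors v))

    bound≡ : bound E t ≡ + suc (sum (map excess others))
    bound≡ = cong (λ z → + 1 ℤ.+ z)
      (sumℤ-pred (outdeg E) others
        (All.tabulate (λ v∈others → outdeg-positive _ (∈-others⁻ v∈others))))

lemma13 : (n : ℕ) (E : Digraph n) (s t : Fin n) → Acyclic E
          → VerticesOnPaths E s t → EdgesOnPaths E s t
          → ∃ λ (ps : List (List (Fin n))) → All (IsPath E s t) ps × Unique ps
              × bound E t ≤ + (length ps)
lemma13 n E s t acyclic onPaths _ =
  walksTo n s , All.tabulate (walksTo-path acyclic) , walksTo-unique n s , counted
  where
  open WalksInto E t

  short : ∀ {v x xs} → Walk E v x xs → length xs ≤ℕ suc n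
  short walk = ℕ.m≤n⇒m≤1+n (acyclic⇒walk-length≤ acyclic walk)

  out-edge : ∀ v → v ≢ t → ∃ (Edge E v)
  out-edge v v≢t = let _ , (walk , _) , v∈p = onPaths v in walk-out-edge walk v∈p v≢t

  covered : ∀ u → u ∈ concat (walksTo n s)
  covered u = let _ , (walk , _) , u∈p = onPaths u in
    ∈-concat⁺′ u∈p (walksTo-complete acyclic n walk (short walk))

  open Count out-edge

  counted : bound E t ≤ + length (walksTo n s)
  counted = begin
    bound E t
      ≡⟨ bound≡ ⟩
    + suc (sum (map excess others))
      ≡⟨ cong (+_ ∘ suc) (weight-complete others covered) ⟨
    + suc (weight others (concat (walksTo n s)))
      ≤⟨ ℤ.+≤+ (walksTo-count n s short) ⟩
    + length (walksTo n s) ∎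
    where open ℤ.≤-Reasoning
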